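{- Let $p$ be a prime and $N\ge1$ an integer with $p\nmid N$ and $pN>3$, and let $d$ and $d_p$ be as in the context. Then $d$ and $d_p$ are non-decreasing functions on $\mathbb Z$.
   Context: Let $\delta=p-1$ if $p$ is odd and $\delta=2$ if $p=2$. Let $\mu_0(N)$ be the index of $\Gamma_0(N)$ in $\mathrm{SL}_2(\mathbb Z)$, $c_0(N)$ the number of cusps of $X_0(N)$, $\mu_{0,2}(N)$ and $\mu_{0,3}(N)$ the numbers of elliptic points of order 2 and 3 on $X_0(N)$, and $\left(\frac{a}{b}\right)$ the Kronecker symbol. For $k\in\mathbb Z$ set $$D_k=\frac{(k-1)\mu_0(N)}{12}+\Bigl(\Bigl\lfloor\frac k4\Bigr\rfloor-\frac{k-1}4\Bigr)\mu_{0,2}(N)+\Bigl(\Bigl\lfloor\frac k3\Bigr\rfloor-\frac{k-1}3\Bigr)\mu_{0,3}(N)-\frac{c_0(N)}2,$$ $$D_k^{\mathrm{new}}=\frac{(k-1)(p-1)}{12}\mu_0(N)+\Bigl(\Bigl\lfloor\frac k4\Bigr\rfloor-\frac{k-1}4\Bigr)\Bigl(-1+\Bigl(\frac{ -4}{p}\Bigr)\Bigr)\mu_{0,2}(N)+\Bigl(\Bigl\lfloor\frac k3\Bigr\rfloor-\frac{k-1}3\Bigr)\Bigl(-1+\Bigl(\frac{ -3}{p}\Bigr)\Bigr)\mu_{0,3}(N)$$ (for even $k>2$ these equal $\dim S_k(\Gamma_0(N))$ and $\dim S_k(\Gamma_0(Np))^{p\text{ -new}}$). Fix an even integer $k_0$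 with $2\le k_0<p+1$, set $k_n=k_0+n\delta$, $d(n)=D_{k_n}$, $d^{\mathrm{new}}(n)=D^{\mathrm{new}}_{k_n}$ and $d_p=2d+d^{\mathrm{new}}$. -}

module Defs where

open import Data.Bool using (Bool; true; false; if_then_else_)
open import Data.Nat as ℕ using (ℕ; zero; suc; _∸_; _^_)
open import Data.Nat.DivMod using (_%_)
open import Data.Nat.Divisibility using (_∣?_)
open import Data.Nat.Primality using (prime?)
open import Data.Nat.GCD using (gcd)
open import Data.Integer as ℤ using (ℤ; +_)
open import Data.Integer.DivMod using (_/ℕ_; _%ℕ_)
open import Data.Rational as ℚ using (ℚ; _/_; 0ℚ; 1ℚ; _+_; _*_; _-_)
open import Data.List using (List; filter; upTo; map; foldr; length)
open import Relation.Nullary.Decidable using (⌊_⌋; _×-dec_)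

ℕ→ℚ : ℕ → ℚ
ℕ→ℚ n = (+ n) / 1

ℤ→ℚ : ℤ → ℚ
ℤ→ℚ z = z / 1

prodℚ : List ℚ → ℚ
prodℚ = foldr _*_ 1ℚ

sumℚ : List ℚ → ℚ
sumℚ = foldr _+_ 0ℚ

divisors : ℕ → List ℕ
divisors N = filter (λ d → d ∣? N) (map suc (upTo N))

primeDivisors : ℕ → List ℕ
primeDivisors N = filter (λ q → prime? q) (divisors N)

totient : ℕ → ℕ
totient n = length (filter (λ k → gcd k n ℕ.≟ 1) (map suc (upTo n)))

-- Kronecker symbol (a / q) for q prime:
--   q = 2 : 0 if a even, 1 if a ≡ ±1 (mod 8), -1 if a ≡ ±3 (mod 8);
--   q odd : Legendre symbol, via Euler's criterion a^((q-1)/2) mod q.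
kroneckerPrime : ℤ → ℕ → ℤ
kroneckerPrime a 0 = + 0
kroneckerPrime a 2 = kro2 (a %ℕ 8)
  where
  kro2 : ℕ → ℤ
  kro2 1 = + 1
  kro2 7 = + 1
  kro2 3 = ℤ.- (+ 1)
  kro2 5 = ℤ.- (+ 1)
  kro2 _ = + 0
kroneckerPrime a (suc q) = euler (((a %ℕ suc q) ^ (q ℕ./ 2)) % suc q)
  where
  euler : ℕ → ℤ
  euler 0 = + 0
  euler 1 = + 1
  euler _ = ℤ.- (+ 1)

μ₀ : ℕ → ℚ
μ₀ N = ℕ→ℚ N * prodℚ (map (λ q → 1ℚ + (+ 1) / suc (q ∸ 1)) (primeDivisors N))
-- (primes q are ≥ 2, so suc (q ∸ 1) = q)

-- number of cusps: c₀(N) = Σ_{d | N} φ(gcd(d, N/d))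
c₀ : ℕ → ℚ
c₀ N = sumℚ (map (λ d → ℕ→ℚ (totient (gcd d (N ℕ./ suc (d ∸ 1))))) (divisors N))
-- (divisors d are ≥ 1, so suc (d ∸ 1) = d)

-- elliptic points of order 2: 0 if 4 | N, else ∏_{q | N} (1 + (-4/q))
μ₀₂ : ℕ → ℚ
μ₀₂ N = if ⌊ 4 ∣? N ⌋ then 0ℚ
        else prodℚ (map (λ q → ℤ→ℚ (+ 1 ℤ.+ kroneckerPrime (ℤ.- (+ 4)) q)) (primeDivisors N))

-- elliptic points of order 3: 0 if 9 | N, else ∏_{q | N} (1 + (-3/q))
μ₀₃ : ℕ → ℚ
μ₀₃ N = if ⌊ 9 ∣? N ⌋ then 0ℚ
        else prodℚ (map (λ q → ℤ→ℚ (+ 1 ℤ.+ kroneckerPrime (ℤ.- (+ 3)) q)) (primeDivisors N))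

δ : ℕ → ℕ
δ 2 = 2
δ p = p ∸ 1

corr : ℤ → ℕ → ℚ
corr k m = ℤ→ℚ (k /ℕ suc (m ∸ 1)) - (k ℤ.- + 1) / suc (m ∸ 1)

D : ℕ → ℤ → ℚ
D N k = ((k ℤ.- + 1) / 12) * μ₀ N + corr k 4 * μ₀₂ N + corr k 3 * μ₀₃ N
        - (c₀ N * (+ 1 / 2))

Dnew : ℕ → ℕ → ℤ → ℚ
Dnew p N k =
  ((k ℤ.- + 1) / 12) * ℕ→ℚ (p ∸ 1) * μ₀ N
  + corr k 4 * ℤ→ℚ (ℤ.- (+ 1) ℤ.+ kroneckerPrime (ℤ.- (+ 4)) p) * μ₀₂ N
  + corr k 3 * ℤ→ℚ (ℤ.- (+ 1) ℤ.+ kroneckerPrime (ℤ.- (+ 3)) p) * μ₀₃ N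

kₙ : ℕ → ℕ → ℤ → ℤ
kₙ p k₀ n = + k₀ ℤ.+ n ℤ.* + δ p

d : ℕ → ℕ → ℕ → ℤ → ℚ
d p N k₀ n = D N (kₙ p k₀ n)

dnew : ℕ → ℕ → ℕ → ℤ → ℚ
dnew p N k₀ n = Dnew p N (kₙ p k₀ n)

dₚ : ℕ → ℕ → ℕ → ℤ → ℚ
dₚ p N k₀ n = ℕ→ℚ 2 * d p N k₀ n + dnew p N k₀ n

{-# OPTIONS --safe #-}
module Submission where

-- Passing from k to k + δ adds δ/12 to (k − 1)/12 and lowers each correction ⌊k/m⌋ − (k − 1)/m
-- by at most (δ mod m)/m, so D_{k+δ} − D_k ≥ (δ μ₀ − 3 (δ mod 4) μ₀,₂ − 4 (δ mod 3) μ₀,₃)/12.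
-- This is non-negative. For p ≥ 5, δ = p − 1 is even, whence 3 (δ mod 4) + 4 (δ mod 3) ≤ δ, while
-- μ₀,₂ and μ₀,₃ are at most ∏_{q ∣ N} (q + 1) ≤ μ₀. For p ∈ {2, 3}, δ = 2 and pN > 3 forces N ≥ 2;
-- then 3 μ₀,₂ + 4 μ₀,₃ ≤ μ₀, by the local inequality 3 (1 + (−4/q)) + 4 (1 + (−3/q)) ≤ q + 1 at one
-- prime q ∣ N and the bounds 1 + (−4/q), 1 + (−3/q) ≤ q + 1 at the others. Finally 2 d + d^new has
-- the shape of d, with μ₀, μ₀,₂, μ₀,₃ weighted by p + 1, 1 + (−4/p), 1 + (−3/p) ∈ [0, 2], so the
-- same bound applies to it.

open import Level using (0ℓ)
open import Data.Unit using (tt)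
open import Data.Bool using (true; false; if_then_else_)
open import Data.Empty using (⊥-elim)
open import Data.Product using (_×_; _,_; proj₁; proj₂)
open import Data.Sum using (inj₁; inj₂)
open import Data.Nat as ℕ using (ℕ; zero; suc; _∸_; z≤n; s≤s; NonZero)
import Data.Nat.Properties as ℕP
open import Data.Nat.DivMod as ℕD using (_%_)
open import Data.Nat.Divisibility using (_∣_; _∤_; _∣?_; divides; ∣⇒≤; ∣1⇒≡1; m%n≡0⇒n∣m)
open import Data.Nat.Coprimality using (Coprime; coprime⇒gcd≡1)
open import Data.Nat.LCM using (lcm; lcm-least; gcd*lcm)
open import Data.Nat.ListAction using (product)
open import Data.Nat.Primality
  using ( Prime; prime?; prime⇒nonZero; prime⇒irreducible; euclidsLemma
        ; ¬prime[0]; ¬prime[1]; composite[4]; composite⇒¬prime)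
open import Data.Nat.Primality.Factorisation using (factorise; PrimeFactorisation)
open import Data.Integer as ℤ using (ℤ; +_; +≤+; -≤+; -≤-; 0ℤ; 1ℤ; -1ℤ)
import Data.Integer.Properties as ℤP
open import Data.Integer.DivMod using (_/ℕ_; _%ℕ_; [n/ℕd]*d≤n; n<s[n/ℕd]*d)
open import Data.Integer.Tactic.RingSolver using () renaming (solve-∀ to solve-ℤ)
open import Data.Rational as ℚ using (ℚ)
import Data.Rational.Properties as ℚP
open import Data.Rational.Unnormalised as ℚᵘ using (mkℚᵘ; *≡*; *≤*)
import Data.Rational.Unnormalised.Properties as ℚᵘP
open import Data.List using (List; []; _∷_; map; upTo)
open import Data.List.Relation.Unary.All as All using (All; []; _∷_)
open import Data.List.Relation.Unary.AllPairs using ([]; _∷_)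
open import Data.List.Relation.Unary.Unique.Propositional using (Unique)
import Data.List.Relation.Unary.Unique.Propositional.Properties as Unique
open import Data.List.Membership.Propositional using (_∈_)
open import Data.List.Membership.Propositional.Properties using (∉[]; ∈-filter⁺; ∈-filter⁻; ∈-map⁺; ∈-upTo⁺)
open import Relation.Nullary using (¬_)
open import Relation.Binary.PropositionalEquality
open import Relation.Binary.Bundles using (Preorder; TotalPreorder)

open import Defs

-- ℚ's order and arithmetic are opened only inside this module: the statement below uses ℕ's.
module _ where
  open import Data.Rational using (_/_; _+_; _*_; _-_; 0ℚ; 1ℚ; _≤_; toℚᵘ; fromℚᵘ)
  open import Data.Rational.Solver using (module +-*-Solver)
  open +-*-Solver using (solve; _:+_; _:*_; _:-_; con; _:=_)

  fromℚᵘ-homo-+ : ∀ x y → fromℚᵘ (x ℚᵘ.+ y) ≡ fromℚᵘ x + fromℚᵘ y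
  fromℚᵘ-homo-+ x y = begin
    fromℚᵘ (x ℚᵘ.+ y)                             ≡⟨ ℚP.fromℚᵘ-cong (ℚᵘP.+-cong (toℚᵘ∘fromℚᵘ x) (toℚᵘ∘fromℚᵘ y)) ⟩
    fromℚᵘ (toℚᵘ (fromℚᵘ x) ℚᵘ.+ toℚᵘ (fromℚᵘ y)) ≡⟨ ℚP.fromℚᵘ-cong (ℚᵘP.≃-sym (ℚP.toℚᵘ-homo-+ (fromℚᵘ x) (fromℚᵘ y))) ⟩
    fromℚᵘ (toℚᵘ (fromℚᵘ x + fromℚᵘ y))           ≡⟨ ℚP.fromℚᵘ-toℚᵘ _ ⟩
    fromℚᵘ x + fromℚᵘ y                           ∎
    where
    open ≡-Reasoning
    toℚᵘ∘fromℚᵘ : ∀ z → z ℚᵘ.≃ toℚᵘ (fromℚᵘ z)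
    toℚᵘ∘fromℚᵘ z = ℚᵘP.≃-sym (ℚP.toℚᵘ-fromℚᵘ z)

  fromℚᵘ-homo-* : ∀ x y → fromℚᵘ (x ℚᵘ.* y) ≡ fromℚᵘ x * fromℚᵘ y
  fromℚᵘ-homo-* x y = begin
    fromℚᵘ (x ℚᵘ.* y)                             ≡⟨ ℚP.fromℚᵘ-cong (ℚᵘP.*-cong (toℚᵘ∘fromℚᵘ x) (toℚᵘ∘fromℚᵘ y)) ⟩
    fromℚᵘ (toℚᵘ (fromℚᵘ x) ℚᵘ.* toℚᵘ (fromℚᵘ y)) ≡⟨ ℚP.fromℚᵘ-cong (ℚᵘP.≃-sym (ℚP.toℚᵘ-homo-* (fromℚᵘ x) (fromℚᵘ y))) ⟩
    fromℚᵘ (toℚᵘ (fromℚᵘ x * fromℚᵘ y))           ≡⟨ ℚP.fromℚᵘ-toℚᵘ _ ⟩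
    fromℚᵘ x * fromℚᵘ y                           ∎
    where
    open ≡-Reasoning
    toℚᵘ∘fromℚᵘ : ∀ z → z ℚᵘ.≃ toℚᵘ (fromℚᵘ z)
    toℚᵘ∘fromℚᵘ z = ℚᵘP.≃-sym (ℚP.toℚᵘ-fromℚᵘ z)

  ℤ→ℚ-homo-+ : ∀ i j → ℤ→ℚ (i ℤ.+ j) ≡ ℤ→ℚ i + ℤ→ℚ j
  ℤ→ℚ-homo-+ i j = trans (ℚP.fromℚᵘ-cong {mkℚᵘ (i ℤ.+ j) 0} {mkℚᵘ i 0 ℚᵘ.+ mkℚᵘ j 0} (*≡* (eq i j)))
                         (fromℚᵘ-homo-+ (mkℚᵘ i 0) (mkℚᵘ j 0))
    where
    eq : ∀ i j → (i ℤ.+ j) ℤ.* + 1 ≡ (i ℤ.* + 1 ℤ.+ j ℤ.* + 1) ℤ.* + 1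
    eq = solve-ℤ

  ℤ→ℚ-homo-* : ∀ i j → ℤ→ℚ (i ℤ.* j) ≡ ℤ→ℚ i * ℤ→ℚ j
  ℤ→ℚ-homo-* i j = fromℚᵘ-homo-* (mkℚᵘ i 0) (mkℚᵘ j 0)

  ℤ→ℚ-mono-≤ : ∀ {i j} → i ℤ.≤ j → ℤ→ℚ i ≤ ℤ→ℚ j
  ℤ→ℚ-mono-≤ {i} {j} i≤j = ℚP.toℚᵘ-cancel-≤
    (ℚᵘP.≤-respʳ-≃ (ℚᵘP.≃-sym (ℚP.toℚᵘ-fromℚᵘ (mkℚᵘ j 0)))
      (ℚᵘP.≤-respˡ-≃ (ℚᵘP.≃-sym (ℚP.toℚᵘ-fromℚᵘ (mkℚᵘ i 0)))
        (*≤* (ℤP.*-monoʳ-≤-nonNeg (+ 1) i≤j))))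

  ℕ→ℚ-homo-+ : ∀ m n → ℕ→ℚ (m ℕ.+ n) ≡ ℕ→ℚ m + ℕ→ℚ n
  ℕ→ℚ-homo-+ m n = trans (cong ℤ→ℚ (ℤP.pos-+ m n)) (ℤ→ℚ-homo-+ (+ m) (+ n))

  ℕ→ℚ-homo-* : ∀ m n → ℕ→ℚ (m ℕ.* n) ≡ ℕ→ℚ m * ℕ→ℚ n
  ℕ→ℚ-homo-* m n = trans (cong ℤ→ℚ (ℤP.pos-* m n)) (ℤ→ℚ-homo-* (+ m) (+ n))

  ℕ→ℚ-mono-≤ : ∀ {m n} → m ℕ.≤ n → ℕ→ℚ m ≤ ℕ→ℚ n
  ℕ→ℚ-mono-≤ {m} {n} m≤n = ℤ→ℚ-mono-≤ {+ m} {+ n} (+≤+ m≤n)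

  ℕ→ℚ-nonNeg : ∀ n → 0ℚ ≤ ℕ→ℚ n
  ℕ→ℚ-nonNeg n = ℕ→ℚ-mono-≤ {0} {n} z≤n

  i/n≡i*[1/n] : ∀ i m → i / suc m ≡ ℤ→ℚ i * (+ 1 / suc m)
  i/n≡i*[1/n] i m = trans (ℚP.fromℚᵘ-cong {mkℚᵘ i m} {mkℚᵘ i 0 ℚᵘ.* mkℚᵘ (+ 1) m} (*≡* (eq i)))
                          (fromℚᵘ-homo-* (mkℚᵘ i 0) (mkℚᵘ (+ 1) m))
    where
    eq : ∀ i → i ℤ.* + (1 ℕ.* suc m) ≡ (i ℤ.* + 1) ℤ.* + suc m
    eq i = cong₂ ℤ._*_ (sym (ℤP.*-identityʳ i)) (cong +_ (ℕP.*-identityˡ (suc m)))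

  n*[1/n]≡1 : ∀ m → ℕ→ℚ (suc m) * (+ 1 / suc m) ≡ 1ℚ
  n*[1/n]≡1 m = trans (sym (i/n≡i*[1/n] (+ suc m) m))
                      (ℚP.fromℚᵘ-cong {mkℚᵘ (+ suc m) m} {mkℚᵘ (+ 1) 0} (*≡* (ℤP.*-comm (+ suc m) (+ 1))))

  *-monoˡ-≤-0≤ : ∀ {r p q} → 0ℚ ≤ r → p ≤ q → r * p ≤ r * q
  *-monoˡ-≤-0≤ {r} 0≤r = ℚP.*-monoˡ-≤-nonNeg r {{ℚ.nonNegative 0≤r}}

  *-monoʳ-≤-0≤ : ∀ {r p q} → 0ℚ ≤ r → p ≤ q → p * r ≤ q * r
  *-monoʳ-≤-0≤ {r} 0≤r = ℚP.*-monoʳ-≤-nonNeg r {{ℚ.nonNegative 0≤r}}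

  0≤p*q : ∀ {p q} → 0ℚ ≤ p → 0ℚ ≤ q → 0ℚ ≤ p * q
  0≤p*q {p} 0≤p 0≤q = ℚP.≤-trans (ℚP.≤-reflexive (sym (ℚP.*-zeroʳ p))) (*-monoˡ-≤-0≤ 0≤p 0≤q)

  p≤p+q : ∀ {p q} → 0ℚ ≤ q → p ≤ p + q
  p≤p+q {p} 0≤q = ℚP.≤-trans (ℚP.≤-reflexive (sym (ℚP.+-identityʳ p))) (ℚP.+-monoʳ-≤ p 0≤q)

  p≤q⇒0≤q-p : ∀ {p q} → p ≤ q → 0ℚ ≤ q - p
  p≤q⇒0≤q-p {p} p≤q = ℚP.≤-trans (ℚP.≤-reflexive (sym (ℚP.+-inverseʳ p))) (ℚP.+-monoˡ-≤ (ℚ.- p) p≤q)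

  -- Shifting the weight k by δ

  [i/n]+[m/n]≤[i+m]/n : ∀ i m n .{{_ : NonZero n}} → i /ℕ n ℤ.+ + (m ℕ./ n) ℤ.≤ (i ℤ.+ + m) /ℕ n
  [i/n]+[m/n]≤[i+m]/n i m n = ℤP.≤-trans (ℤP.i<j⇒i≤pred[j] q+t<q'+1) (ℤP.≤-reflexive (ℤP.pred-suc q'))
    where
    q = i /ℕ n
    t = m ℕ./ n
    q' = (i ℤ.+ + m) /ℕ n
    [q+t]*n≤i+m : (q ℤ.+ + t) ℤ.* + n ℤ.≤ i ℤ.+ + m
    [q+t]*n≤i+m = ℤP.≤-trans (ℤP.≤-reflexive (ℤP.*-distribʳ-+ (+ n) q (+ t)))
      (ℤP.+-mono-≤ ([n/ℕd]*d≤n i n) (ℤP.≤-trans (ℤP.≤-reflexive (sym (ℤP.pos-* t n))) (+≤+ (ℕD.m/n*n≤m m n))))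
    q+t<q'+1 : q ℤ.+ + t ℤ.< ℤ.suc q'
    q+t<q'+1 = ℤP.*-cancelʳ-<-nonNeg (+ n) (ℤP.≤-<-trans [q+t]*n≤i+m (n<s[n/ℕd]*d (i ℤ.+ + m) n))

  [i+j]/n≡i/n+j/n : ∀ i j m → (i ℤ.+ j) / suc m ≡ i / suc m + j / suc m
  [i+j]/n≡i/n+j/n i j m = begin
    (i ℤ.+ j) / suc m                ≡⟨ i/n≡i*[1/n] (i ℤ.+ j) m ⟩
    ℤ→ℚ (i ℤ.+ j) * I                ≡⟨ cong (_* I) (ℤ→ℚ-homo-+ i j) ⟩
    (ℤ→ℚ i + ℤ→ℚ j) * I              ≡⟨ ℚP.*-distribʳ-+ I (ℤ→ℚ i) (ℤ→ℚ j) ⟩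
    ℤ→ℚ i * I + ℤ→ℚ j * I            ≡⟨ sym (cong₂ _+_ (i/n≡i*[1/n] i m) (i/n≡i*[1/n] j m)) ⟩
    i / suc m + j / suc m            ∎
    where
    open ≡-Reasoning
    I = + 1 / suc m

  [k+δ-1]/n≡[k-1]/n+δ/n : ∀ k δ m → (k ℤ.+ + δ ℤ.- + 1) / suc m ≡ (k ℤ.- + 1) / suc m + ℕ→ℚ δ * (+ 1 / suc m)
  [k+δ-1]/n≡[k-1]/n+δ/n k δ m = begin
    (k ℤ.+ + δ ℤ.- + 1) / suc m           ≡⟨ cong (λ i → i / suc m) (reorder k (+ δ)) ⟩
    (k ℤ.- + 1 ℤ.+ + δ) / suc m           ≡⟨ [i+j]/n≡i/n+j/n (k ℤ.- + 1) (+ δ) m ⟩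
    (k ℤ.- + 1) / suc m + + δ / suc m     ≡⟨ cong (_+_ ((k ℤ.- + 1) / suc m)) (i/n≡i*[1/n] (+ δ) m) ⟩
    (k ℤ.- + 1) / suc m + ℕ→ℚ δ * (+ 1 / suc m) ∎
    where
    open ≡-Reasoning
    reorder : ∀ k d → k ℤ.+ d ℤ.- + 1 ≡ k ℤ.- + 1 ℤ.+ d
    reorder = solve-ℤ

  a*[1/n]≡[a%n]*[1/n]+[a/n] : ∀ a m → ℕ→ℚ a * (+ 1 / suc m) ≡ ℕ→ℚ (a % suc m) * (+ 1 / suc m) + ℕ→ℚ (a ℕ./ suc m)
  a*[1/n]≡[a%n]*[1/n]+[a/n] a m = begin
    ℕ→ℚ a * I                  ≡⟨ cong (λ x → ℕ→ℚ x * I) (ℕD.m≡m%n+[m/n]*n a (suc m)) ⟩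
    ℕ→ℚ (s ℕ.+ t ℕ.* n) * I    ≡⟨ cong (_* I) (trans (ℕ→ℚ-homo-+ s (t ℕ.* n)) (cong (_+_ (ℕ→ℚ s)) (ℕ→ℚ-homo-* t n))) ⟩
    (S + T * ℕ→ℚ n) * I        ≡⟨ expand S T (ℕ→ℚ n) I ⟩
    S * I + T * (ℕ→ℚ n * I)    ≡⟨ cong (λ x → S * I + T * x) (n*[1/n]≡1 m) ⟩
    S * I + T * 1ℚ             ≡⟨ cong (_+_ (S * I)) (ℚP.*-identityʳ T) ⟩
    S * I + T                  ∎
    where
    open ≡-Reasoning
    n = suc m
    I = + 1 / n
    s = a % n
    t = a ℕ./ n
    S = ℕ→ℚ s
    T = ℕ→ℚ t
    expand : ∀ S T N I → (S + T * N) * I ≡ S * I + T * (N * I)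
    expand = solve 4 (λ S T N I → (S :+ T :* N) :* I := S :* I :+ T :* (N :* I)) refl

  corr[k]-[δ%n]/n≤corr[k+δ] : ∀ k δ m → corr k (suc m) - ℕ→ℚ (δ % suc m) * (+ 1 / suc m) ≤ corr (k ℤ.+ + δ) (suc m)
  corr[k]-[δ%n]/n≤corr[k+δ] k δ m = begin
    corr k n - S * I                       ≡⟨ cancel-T (ℤ→ℚ q) A (S * I) T ⟩
    (ℤ→ℚ q + T) - (A + (S * I + T))        ≡⟨ cong (_- (A + (S * I + T))) (ℤ→ℚ-homo-+ q (+ t)) ⟨
    ℤ→ℚ (q ℤ.+ + t) - (A + (S * I + T))    ≤⟨ ℚP.+-monoˡ-≤ _ (ℤ→ℚ-mono-≤ ([i/n]+[m/n]≤[i+m]/n k δ n)) ⟩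
    ℤ→ℚ q' - (A + (S * I + T))             ≡⟨ cong (ℤ→ℚ q' -_) split ⟨
    corr (k ℤ.+ + δ) n                     ∎
    where
    open ℚP.≤-Reasoning
    n = suc m
    I = + 1 / n
    q = k /ℕ n
    q' = (k ℤ.+ + δ) /ℕ n
    t = δ ℕ./ n
    S = ℕ→ℚ (δ % n)
    T = ℕ→ℚ t
    A = (k ℤ.- + 1) / n
    split : (k ℤ.+ + δ ℤ.- + 1) / n ≡ A + (S * I + T)
    split = trans ([k+δ-1]/n≡[k-1]/n+δ/n k δ m) (cong (_+_ A) (a*[1/n]≡[a%n]*[1/n]+[a/n] δ m))
    cancel-T : ∀ Q A SI T → Q - A - SI ≡ (Q + T) - (A + (SI + T))
    cancel-T = solve 4 (λ Q A SI T → Q :- A :- SI := (Q :+ T) :- (A :+ (SI :+ T))) refl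

  -- D N k is literally Dformula k (μ₀ N) (μ₀₂ N) (μ₀₃ N) (c₀ N * ½).
  Dformula : ℤ → ℚ → ℚ → ℚ → ℚ → ℚ
  Dformula k M X Y C = ((k ℤ.- + 1) / 12) * M + corr k 4 * X + corr k 3 * Y - C

  Dformula-mono-+δ : ∀ δ {M X Y C} → 0ℚ ≤ X → 0ℚ ≤ Y →
    ℕ→ℚ (3 ℕ.* (δ % 4)) * X + ℕ→ℚ (4 ℕ.* (δ % 3)) * Y ≤ ℕ→ℚ δ * M →
    ∀ k → Dformula k M X Y C ≤ Dformula (k ℤ.+ + δ) M X Y C
  Dformula-mono-+δ δ {M} {X} {Y} {C} 0≤X 0≤Y W≤ΔM k = begin
    Dformula k M X Y C
      ≤⟨ p≤p+q (0≤p*q (ℚP.nonNegative⁻¹ (+ 1 / 12)) (p≤q⇒0≤q-p W≤ΔM′)) ⟩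
    Dformula k M X Y C + (+ 1 / 12) * (Δ * M - W)
      ≡⟨ regroup A Δ M c₄ X c₃ Y C S₄ S₃ ⟩
    (A + Δ * (+ 1 / 12)) * M + (c₄ - S₄ * (+ 1 / 4)) * X + (c₃ - S₃ * (+ 1 / 3)) * Y - C
      ≤⟨ ℚP.+-monoˡ-≤ (ℚ.- C) (ℚP.+-mono-≤
           (ℚP.+-monoʳ-≤ ((A + Δ * (+ 1 / 12)) * M) (*-monoʳ-≤-0≤ 0≤X (corr[k]-[δ%n]/n≤corr[k+δ] k δ 3)))
           (*-monoʳ-≤-0≤ 0≤Y (corr[k]-[δ%n]/n≤corr[k+δ] k δ 2))) ⟩
    (A + Δ * (+ 1 / 12)) * M + corr k′ 4 * X + corr k′ 3 * Y - C
      ≡⟨ cong (λ a → a * M + corr k′ 4 * X + corr k′ 3 * Y - C) ([k+δ-1]/n≡[k-1]/n+δ/n k δ 11) ⟨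
    Dformula k′ M X Y C
      ∎
    where
    open ℚP.≤-Reasoning
    k′ = k ℤ.+ + δ
    A = (k ℤ.- + 1) / 12
    c₄ = corr k 4
    c₃ = corr k 3
    Δ = ℕ→ℚ δ
    S₄ = ℕ→ℚ (δ % 4)
    S₃ = ℕ→ℚ (δ % 3)
    W = ℕ→ℚ 3 * S₄ * X + ℕ→ℚ 4 * S₃ * Y
    W≤ΔM′ : W ≤ Δ * M
    W≤ΔM′ = ℚP.≤-trans (ℚP.≤-reflexive (sym (cong₂ (λ a b → a * X + b * Y)
      (ℕ→ℚ-homo-* 3 (δ % 4)) (ℕ→ℚ-homo-* 4 (δ % 3))))) W≤ΔM
    regroup : ∀ A Δ M c₄ X c₃ Y C S₄ S₃ →
      A * M + c₄ * X + c₃ * Y - C + (+ 1 / 12) * (Δ * M - (ℕ→ℚ 3 * S₄ * X + ℕ→ℚ 4 * S₃ * Y))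
      ≡ (A + Δ * (+ 1 / 12)) * M + (c₄ - S₄ * (+ 1 / 4)) * X + (c₃ - S₃ * (+ 1 / 3)) * Y - C
    regroup = solve 10 (λ A Δ M c₄ X c₃ Y C S₄ S₃ →
        A :* M :+ c₄ :* X :+ c₃ :* Y :- C
          :+ con (+ 1 / 12) :* (Δ :* M :- (con (ℕ→ℚ 3) :* S₄ :* X :+ con (ℕ→ℚ 4) :* S₃ :* Y))
      := (A :+ Δ :* con (+ 1 / 12)) :* M :+ (c₄ :- S₄ :* con (+ 1 / 4)) :* X :+ (c₃ :- S₃ :* con (+ 1 / 3)) :* Y :- C)
      refl

  ∈-primeDivisors⁻ : ∀ {N q} → q ∈ primeDivisors N → Prime q × q ∣ N
  ∈-primeDivisors⁻ {N} q∈ with q∈divisors , q-prime ← ∈-filter⁻ prime? {xs = divisors N} q∈ =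
    q-prime , proj₂ (∈-filter⁻ (_∣? N) {xs = map suc (upTo N)} q∈divisors)

  ∈-primeDivisors⁺ : ∀ {N q} → .{{NonZero N}} → Prime q → q ∣ N → q ∈ primeDivisors N
  ∈-primeDivisors⁺ {q = zero}  q-prime _   = ⊥-elim (¬prime[0] q-prime)
  ∈-primeDivisors⁺ {N} {suc q} q-prime q∣N =
    ∈-filter⁺ prime? (∈-filter⁺ (_∣? N) (∈-map⁺ suc (∈-upTo⁺ (∣⇒≤ q∣N))) q∣N) q-prime

  primeDivisors-unique : ∀ N → Unique (primeDivisors N)
  primeDivisors-unique N =
    Unique.filter⁺ prime? (Unique.filter⁺ (_∣? N) (Unique.map⁺ ℕP.suc-injective (Unique.upTo⁺ N)))

  primeDivisors≢[] : ∀ {N} → 2 ℕ.≤ N → primeDivisors N ≢ []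
  primeDivisors≢[] {suc zero} (s≤s ())
  primeDivisors≢[] {N@(suc (suc _))} _ = first-factor isFactorisation factorsPrime
    where
    open PrimeFactorisation (factorise N)
    first-factor : ∀ {fs} → N ≡ product fs → All Prime fs → primeDivisors N ≢ []
    first-factor {q ∷ fs} N≡q*P (q-prime ∷ _) no-primes = ∉[] (subst (q ∈_) no-primes q∈)
      where
      q∈ : q ∈ primeDivisors N
      q∈ = ∈-primeDivisors⁺ q-prime (divides (product fs) (trans N≡q*P (ℕP.*-comm q (product fs))))

  prime∤product : ∀ {q ps} → Prime q → All Prime ps → All (q ≢_) ps → q ∤ product ps
  prime∤product {ps = []} q-prime _ _ q∣1 = ¬prime[1] (subst Prime (∣1⇒≡1 q∣1) q-prime)
  prime∤product {q} {r ∷ ps} q-prime (r-prime ∷ ps-prime) (q≢r ∷ q∉ps) q∣r*P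
    with euclidsLemma r (product ps) q-prime q∣r*P
  ... | inj₂ q∣P = prime∤product q-prime ps-prime q∉ps q∣P
  ... | inj₁ q∣r with prime⇒irreducible r-prime q∣r
  ...   | inj₁ q≡1 = ¬prime[1] (subst Prime q≡1 q-prime)
  ...   | inj₂ q≡r = q≢r q≡r

  prime∤⇒coprime : ∀ {q m} → Prime q → q ∤ m → Coprime q m
  prime∤⇒coprime q-prime q∤m (i∣q , i∣m) with prime⇒irreducible q-prime i∣q
  ... | inj₁ i≡1 = i≡1
  ... | inj₂ refl = ⊥-elim (q∤m i∣m)

  coprime⇒*∣ : ∀ {m n c} → Coprime m n → m ∣ c → n ∣ c → m ℕ.* n ∣ c
  coprime⇒*∣ {m} {n} coprime m∣c n∣c = subst (_∣ _) lcm≡m*n (lcm-least m∣c n∣c)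
    where
    lcm≡m*n : lcm m n ≡ m ℕ.* n
    lcm≡m*n = trans (sym (ℕP.*-identityˡ (lcm m n)))
      (trans (cong (ℕ._* lcm m n) (sym (coprime⇒gcd≡1 coprime))) (gcd*lcm m n))

  product-distinctPrimes∣ : ∀ {n ps} → All (λ q → Prime q × q ∣ n) ps → Unique ps → product ps ∣ n
  product-distinctPrimes∣ {n} [] [] = divides n (sym (ℕP.*-identityʳ n))
  product-distinctPrimes∣ ((q-prime , q∣n) ∷ ps-div) (q∉ps ∷ ps-unique) =
    coprime⇒*∣ (prime∤⇒coprime q-prime (prime∤product q-prime (All.map proj₁ ps-div) q∉ps))
      q∣n (product-distinctPrimes∣ ps-div ps-unique)

  product-primeDivisors∣N : ∀ N → product (primeDivisors N) ∣ N
  product-primeDivisors∣N N = product-distinctPrimes∣ (All.tabulate ∈-primeDivisors⁻) (primeDivisors-unique N)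

  -- Local factors of μ₀, μ₀₂ and μ₀₃

  -1≤kroneckerPrime≤1 : ∀ a q → -1ℤ ℤ.≤ kroneckerPrime a q × kroneckerPrime a q ℤ.≤ 1ℤ
  -1≤kroneckerPrime≤1 a 0 = -≤+ , +≤+ z≤n
  -1≤kroneckerPrime≤1 a 1 = -≤+ , +≤+ z≤n
  -1≤kroneckerPrime≤1 a 2 with a %ℕ 8
  ... | 1 = -≤+ , +≤+ (s≤s z≤n)
  ... | 7 = -≤+ , +≤+ (s≤s z≤n)
  ... | 3 = -≤- z≤n , -≤+
  ... | 5 = -≤- z≤n , -≤+
  ... | 0 = -≤+ , +≤+ z≤n
  ... | 2 = -≤+ , +≤+ z≤n
  ... | 4 = -≤+ , +≤+ z≤n
  ... | 6 = -≤+ , +≤+ z≤n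
  ... | suc (suc (suc (suc (suc (suc (suc (suc _))))))) = -≤+ , +≤+ z≤n
  -1≤kroneckerPrime≤1 a q@(suc (suc (suc _))) with ((a %ℕ q) ℕ.^ (ℕ.pred q ℕ./ 2)) % q
  ... | 0 = -≤+ , +≤+ z≤n
  ... | 1 = -≤+ , +≤+ (s≤s z≤n)
  ... | suc (suc _) = -≤- z≤n , -≤+

  ellipticFactor : ℤ → ℕ → ℤ
  ellipticFactor a q = 1ℤ ℤ.+ kroneckerPrime a q

  0≤ellipticFactor≤2 : ∀ a q → 0ℤ ℤ.≤ ellipticFactor a q × ellipticFactor a q ℤ.≤ + 2
  0≤ellipticFactor≤2 a q = ℤP.+-monoʳ-≤ 1ℤ -1≤χ , ℤP.+-monoʳ-≤ 1ℤ χ≤1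
    where
    -1≤χ : -1ℤ ℤ.≤ kroneckerPrime a q
    -1≤χ = proj₁ (-1≤kroneckerPrime≤1 a q)
    χ≤1 : kroneckerPrime a q ℤ.≤ 1ℤ
    χ≤1 = proj₂ (-1≤kroneckerPrime≤1 a q)

  weightedEllipticFactors≤q+1 : ∀ q → Prime q →
    + 3 ℤ.* ellipticFactor (ℤ.- + 4) q ℤ.+ + 4 ℤ.* ellipticFactor (ℤ.- + 3) q ℤ.≤ + suc q
  weightedEllipticFactors≤q+1 0  q-prime = ⊥-elim (¬prime[0] q-prime)
  weightedEllipticFactors≤q+1 1  q-prime = ⊥-elim (¬prime[1] q-prime)
  weightedEllipticFactors≤q+1 4  q-prime = ⊥-elim (composite⇒¬prime composite[4] q-prime)
  weightedEllipticFactors≤q+1 2  _ = +≤+ (ℕP.≤ᵇ⇒≤ _ _ tt)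
  weightedEllipticFactors≤q+1 3  _ = +≤+ (ℕP.≤ᵇ⇒≤ _ _ tt)
  weightedEllipticFactors≤q+1 5  _ = +≤+ (ℕP.≤ᵇ⇒≤ _ _ tt)
  weightedEllipticFactors≤q+1 6  _ = +≤+ (ℕP.≤ᵇ⇒≤ _ _ tt)
  weightedEllipticFactors≤q+1 7  _ = +≤+ (ℕP.≤ᵇ⇒≤ _ _ tt)
  weightedEllipticFactors≤q+1 8  _ = +≤+ (ℕP.≤ᵇ⇒≤ _ _ tt)
  weightedEllipticFactors≤q+1 9  _ = +≤+ (ℕP.≤ᵇ⇒≤ _ _ tt)
  weightedEllipticFactors≤q+1 10 _ = +≤+ (ℕP.≤ᵇ⇒≤ _ _ tt)
  weightedEllipticFactors≤q+1 11 _ = +≤+ (ℕP.≤ᵇ⇒≤ _ _ tt)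
  weightedEllipticFactors≤q+1 12 _ = +≤+ (ℕP.≤ᵇ⇒≤ _ _ tt)
  weightedEllipticFactors≤q+1 q@(suc (suc (suc (suc (suc (suc (suc (suc (suc (suc (suc (suc (suc r))))))))))))) _ =
    ℤP.≤-trans (ℤP.+-mono-≤ (ℤP.*-monoˡ-≤-nonNeg (+ 3) (proj₂ (0≤ellipticFactor≤2 (ℤ.- + 4) q)))
                            (ℤP.*-monoˡ-≤-nonNeg (+ 4) (proj₂ (0≤ellipticFactor≤2 (ℤ.- + 3) q))))
               (+≤+ (ℕP.m≤m+n 14 r))

  ∏ : {A : Set} → (A → ℚ) → List A → ℚ
  ∏ f xs = prodℚ (map f xs)

  0≤_≤_ : {A : Set} → (A → ℚ) → (A → ℚ) → A → Set
  (0≤ f ≤ g) x = 0ℚ ≤ f x × f x ≤ g x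

  module _ {A : Set} where

    ∏-nonNeg : ∀ {f : A → ℚ} xs → All (λ x → 0ℚ ≤ f x) xs → 0ℚ ≤ ∏ f xs
    ∏-nonNeg []       []          = ℚP.nonNegative⁻¹ 1ℚ
    ∏-nonNeg (x ∷ xs) (0≤fx ∷ 0≤f) = 0≤p*q 0≤fx (∏-nonNeg xs 0≤f)

    ∏-mono-≤ : ∀ {f g : A → ℚ} xs → All (0≤ f ≤ g) xs → ∏ f xs ≤ ∏ g xs
    ∏-mono-≤ []       []                    = ℚP.≤-refl
    ∏-mono-≤ (x ∷ xs) ((0≤fx , fx≤gx) ∷ f≤g) =
      ℚP.≤-trans (*-monoʳ-≤-0≤ (∏-nonNeg xs (All.map proj₁ f≤g)) fx≤gx)
                 (*-monoˡ-≤-0≤ (ℚP.≤-trans 0≤fx fx≤gx) (∏-mono-≤ xs f≤g))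

    ∏-* : ∀ (f g : A → ℚ) xs → ∏ (λ x → f x * g x) xs ≡ ∏ f xs * ∏ g xs
    ∏-* f g []       = refl
    ∏-* f g (x ∷ xs) = trans (cong (f x * g x *_) (∏-* f g xs)) (interchange (f x) (g x) (∏ f xs) (∏ g xs))
      where
      interchange : ∀ a b c d → a * b * (c * d) ≡ a * c * (b * d)
      interchange = solve 4 (λ a b c d → a :* b :* (c :* d) := a :* c :* (b :* d)) refl

    ∏-combination-≤ : ∀ {α β} {f g h : A → ℚ} xs → xs ≢ [] → 0ℚ ≤ α → 0ℚ ≤ β →
      All (0≤ f ≤ h) xs → All (0≤ g ≤ h) xs → All (λ x → α * f x + β * g x ≤ h x) xs →
      α * ∏ f xs + β * ∏ g xs ≤ ∏ h xs
    ∏-combination-≤ [] []≢[] _ _ _ _ _ = ⊥-elim ([]≢[] refl)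
    ∏-combination-≤ {α} {β} {f} {g} {h} (x ∷ xs) _ 0≤α 0≤β ((0≤fx , _) ∷ f≤h) ((0≤gx , _) ∷ g≤h) (comb ∷ _) = begin
      α * (f x * ∏ f xs) + β * (g x * ∏ g xs) ≤⟨ ℚP.+-mono-≤ (*-monoˡ-≤-0≤ 0≤α (*-monoˡ-≤-0≤ 0≤fx (∏-mono-≤ xs f≤h)))
                                                             (*-monoˡ-≤-0≤ 0≤β (*-monoˡ-≤-0≤ 0≤gx (∏-mono-≤ xs g≤h))) ⟩
      α * (f x * H) + β * (g x * H)           ≡⟨ factor α β (f x) (g x) H ⟩
      (α * f x + β * g x) * H                 ≤⟨ *-monoʳ-≤-0≤ 0≤H comb ⟩
      h x * H                                 ∎
      where
      open ℚP.≤-Reasoning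
      H = ∏ h xs
      0≤H : 0ℚ ≤ H
      0≤H = ∏-nonNeg xs (All.map (λ (0≤fy , fy≤hy) → ℚP.≤-trans 0≤fy fy≤hy) f≤h)
      factor : ∀ α β a b H → α * (a * H) + β * (b * H) ≡ (α * a + β * b) * H
      factor = solve 5 (λ α β a b H → α :* (a :* H) :+ β :* (b :* H) := (α :* a :+ β :* b) :* H) refl

  ∏-ℕ→ℚ : ∀ xs → ∏ ℕ→ℚ xs ≡ ℕ→ℚ (product xs)
  ∏-ℕ→ℚ []       = refl
  ∏-ℕ→ℚ (x ∷ xs) = trans (cong (ℕ→ℚ x *_) (∏-ℕ→ℚ xs)) (sym (ℕ→ℚ-homo-* x (product xs)))

  localIndex : ℕ → ℚ
  localIndex q = ℕ→ℚ q * (1ℚ + + 1 / suc (q ∸ 1))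

  localIndex[1+q]≡2+q : ∀ q → localIndex (suc q) ≡ ℕ→ℚ (suc (suc q))
  localIndex[1+q]≡2+q q = begin
    n * (1ℚ + I)        ≡⟨ distrib n I ⟩
    n + n * I           ≡⟨ cong (_+_ n) (n*[1/n]≡1 q) ⟩
    n + 1ℚ              ≡⟨ ℕ→ℚ-homo-+ (suc q) 1 ⟨
    ℕ→ℚ (suc q ℕ.+ 1)   ≡⟨ cong ℕ→ℚ (ℕP.+-comm (suc q) 1) ⟩
    ℕ→ℚ (suc (suc q))   ∎
    where
    open ≡-Reasoning
    n = ℕ→ℚ (suc q)
    I = + 1 / suc q
    distrib : ∀ n I → n * (1ℚ + I) ≡ n + n * I
    distrib = solve 2 (λ n I → n :* (con 1ℚ :+ I) := n :+ n :* I) refl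

  ∏localIndex≤μ₀ : ∀ N → .{{NonZero N}} → ∏ localIndex (primeDivisors N) ≤ μ₀ N
  ∏localIndex≤μ₀ N = begin
    ∏ localIndex L                ≡⟨ ∏-* ℕ→ℚ ψ L ⟩
    ∏ ℕ→ℚ L * ∏ ψ L               ≡⟨ cong (_* ∏ ψ L) (∏-ℕ→ℚ L) ⟩
    ℕ→ℚ (product L) * ∏ ψ L       ≤⟨ *-monoʳ-≤-0≤ (∏-nonNeg L (All.tabulate λ {q} _ → 0≤ψ q))
                                                    (ℕ→ℚ-mono-≤ (∣⇒≤ (product-primeDivisors∣N N))) ⟩
    μ₀ N                          ∎
    where
    open ℚP.≤-Reasoning
    L = primeDivisors N
    ψ : ℕ → ℚ
    ψ q = 1ℚ + + 1 / suc (q ∸ 1)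
    0≤ψ : ∀ q → 0ℚ ≤ ψ q
    0≤ψ q = ℚP.+-mono-≤ (ℚP.nonNegative⁻¹ 1ℚ)
                        (ℚP.nonNegative⁻¹ (+ 1 / suc (q ∸ 1)) {{ℚP.normalize-nonNeg 1 (suc (q ∸ 1))}})

  ε : ℤ → ℕ → ℚ
  ε a q = ℤ→ℚ (ellipticFactor a q)

  0≤ε≤localIndex : ∀ a q → .{{NonZero q}} → (0≤ ε a ≤ localIndex) q
  0≤ε≤localIndex a (suc q) =
    ℤ→ℚ-mono-≤ {0ℤ} (proj₁ (0≤ellipticFactor≤2 a (suc q))) ,
    ℚP.≤-trans (ℤ→ℚ-mono-≤ {j = + suc (suc q)}
                 (ℤP.≤-trans (proj₂ (0≤ellipticFactor≤2 a (suc q))) (+≤+ (s≤s (s≤s z≤n)))))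
               (ℚP.≤-reflexive (sym (localIndex[1+q]≡2+q q)))

  3ε₄+4ε₃≤localIndex : ∀ q → Prime q → ℕ→ℚ 3 * ε (ℤ.- + 4) q + ℕ→ℚ 4 * ε (ℤ.- + 3) q ≤ localIndex q
  3ε₄+4ε₃≤localIndex 0       q-prime = ⊥-elim (¬prime[0] q-prime)
  3ε₄+4ε₃≤localIndex (suc q) q-prime = begin
    ℕ→ℚ 3 * ε (ℤ.- + 4) (suc q) + ℕ→ℚ 4 * ε (ℤ.- + 3) (suc q)
      ≡⟨ cong₂ _+_ (ℤ→ℚ-homo-* (+ 3) e₄) (ℤ→ℚ-homo-* (+ 4) e₃) ⟨
    ℤ→ℚ (+ 3 ℤ.* e₄) + ℤ→ℚ (+ 4 ℤ.* e₃)
      ≡⟨ ℤ→ℚ-homo-+ (+ 3 ℤ.* e₄) (+ 4 ℤ.* e₃) ⟨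
    ℤ→ℚ (+ 3 ℤ.* e₄ ℤ.+ + 4 ℤ.* e₃)
      ≤⟨ ℤ→ℚ-mono-≤ (weightedEllipticFactors≤q+1 (suc q) q-prime) ⟩
    ℕ→ℚ (suc (suc q))
      ≡⟨ localIndex[1+q]≡2+q q ⟨
    localIndex (suc q)
      ∎
    where
    open ℚP.≤-Reasoning
    e₄ = ellipticFactor (ℤ.- + 4) (suc q)
    e₃ = ellipticFactor (ℤ.- + 3) (suc q)

  0≤if-then-0-else-y≤y : ∀ b {y} → 0ℚ ≤ y → 0ℚ ≤ (if b then 0ℚ else y) × (if b then 0ℚ else y) ≤ y
  0≤if-then-0-else-y≤y true  0≤y = ℚP.≤-refl , 0≤y
  0≤if-then-0-else-y≤y false 0≤y = 0≤y , ℚP.≤-refl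

  module _ (a : ℤ) (N : ℕ) where

    0≤ε≤localIndex-primeDivisors : All (0≤ ε a ≤ localIndex) (primeDivisors N)
    0≤ε≤localIndex-primeDivisors = All.tabulate λ {q} q∈ →
      0≤ε≤localIndex a q {{prime⇒nonZero (proj₁ (∈-primeDivisors⁻ {N} q∈))}}

    0≤∏ε : 0ℚ ≤ ∏ (ε a) (primeDivisors N)
    0≤∏ε = ∏-nonNeg (primeDivisors N) (All.map proj₁ 0≤ε≤localIndex-primeDivisors)

    ∏ε≤μ₀ : .{{NonZero N}} → ∏ (ε a) (primeDivisors N) ≤ μ₀ N
    ∏ε≤μ₀ = ℚP.≤-trans (∏-mono-≤ (primeDivisors N) 0≤ε≤localIndex-primeDivisors) (∏localIndex≤μ₀ N)

  0≤μ₀₂≤∏ε₄ : ∀ N → 0ℚ ≤ μ₀₂ N × μ₀₂ N ≤ ∏ (ε (ℤ.- + 4)) (primeDivisors N)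
  0≤μ₀₂≤∏ε₄ N = 0≤if-then-0-else-y≤y _ (0≤∏ε (ℤ.- + 4) N)

  0≤μ₀₃≤∏ε₃ : ∀ N → 0ℚ ≤ μ₀₃ N × μ₀₃ N ≤ ∏ (ε (ℤ.- + 3)) (primeDivisors N)
  0≤μ₀₃≤∏ε₃ N = 0≤if-then-0-else-y≤y _ (0≤∏ε (ℤ.- + 3) N)

  0≤μ₀₂≤μ₀ : ∀ N → .{{NonZero N}} → (0≤ μ₀₂ ≤ μ₀) N
  0≤μ₀₂≤μ₀ N = proj₁ (0≤μ₀₂≤∏ε₄ N) , ℚP.≤-trans (proj₂ (0≤μ₀₂≤∏ε₄ N)) (∏ε≤μ₀ (ℤ.- + 4) N)

  0≤μ₀₃≤μ₀ : ∀ N → .{{NonZero N}} → (0≤ μ₀₃ ≤ μ₀) N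
  0≤μ₀₃≤μ₀ N = proj₁ (0≤μ₀₃≤∏ε₃ N) , ℚP.≤-trans (proj₂ (0≤μ₀₃≤∏ε₃ N)) (∏ε≤μ₀ (ℤ.- + 3) N)

  0≤μ₀ : ∀ N → .{{NonZero N}} → 0ℚ ≤ μ₀ N
  0≤μ₀ N = ℚP.≤-trans (proj₁ (0≤μ₀₂≤μ₀ N)) (proj₂ (0≤μ₀₂≤μ₀ N))

  3μ₀₂+4μ₀₃≤μ₀ : ∀ N → 2 ℕ.≤ N → ℕ→ℚ 3 * μ₀₂ N + ℕ→ℚ 4 * μ₀₃ N ≤ μ₀ N
  3μ₀₂+4μ₀₃≤μ₀ 1 (s≤s ())
  3μ₀₂+4μ₀₃≤μ₀ N@(suc (suc _)) 2≤N = begin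
    ℕ→ℚ 3 * μ₀₂ N + ℕ→ℚ 4 * μ₀₃ N
      ≤⟨ ℚP.+-mono-≤ (*-monoˡ-≤-0≤ (ℕ→ℚ-nonNeg 3) (proj₂ (0≤μ₀₂≤∏ε₄ N)))
                     (*-monoˡ-≤-0≤ (ℕ→ℚ-nonNeg 4) (proj₂ (0≤μ₀₃≤∏ε₃ N))) ⟩
    ℕ→ℚ 3 * ∏ (ε (ℤ.- + 4)) L + ℕ→ℚ 4 * ∏ (ε (ℤ.- + 3)) L
      ≤⟨ ∏-combination-≤ L (primeDivisors≢[] 2≤N) (ℕ→ℚ-nonNeg 3) (ℕ→ℚ-nonNeg 4)
           (0≤ε≤localIndex-primeDivisors (ℤ.- + 4) N) (0≤ε≤localIndex-primeDivisors (ℤ.- + 3) N)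
           (All.tabulate λ {q} q∈ → 3ε₄+4ε₃≤localIndex q (proj₁ (∈-primeDivisors⁻ {N} q∈))) ⟩
    ∏ localIndex L
      ≤⟨ ∏localIndex≤μ₀ N ⟩
    μ₀ N ∎
    where
    open ℚP.≤-Reasoning
    L = primeDivisors N

  -- The bound 3 (δ mod 4) μ₀₂ + 4 (δ mod 3) μ₀₃ ≤ δ μ₀

  -- The analogous bound fails for the odd δ = 3, 5, 7, 11, hence the restriction to δ = 2h.
  3[2h%4]+4[2h%3]≤2h : ∀ h → 2 ℕ.≤ h → 3 ℕ.* (2 ℕ.* h % 4) ℕ.+ 4 ℕ.* (2 ℕ.* h % 3) ℕ.≤ 2 ℕ.* h
  3[2h%4]+4[2h%3]≤2h 1 (s≤s ())
  3[2h%4]+4[2h%3]≤2h 2 _ = ℕP.≤ᵇ⇒≤ _ _ tt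
  3[2h%4]+4[2h%3]≤2h 3 _ = ℕP.≤ᵇ⇒≤ _ _ tt
  3[2h%4]+4[2h%3]≤2h 4 _ = ℕP.≤ᵇ⇒≤ _ _ tt
  3[2h%4]+4[2h%3]≤2h 5 _ = ℕP.≤ᵇ⇒≤ _ _ tt
  3[2h%4]+4[2h%3]≤2h 6 _ = ℕP.≤ᵇ⇒≤ _ _ tt
  3[2h%4]+4[2h%3]≤2h 7 _ = ℕP.≤ᵇ⇒≤ _ _ tt
  3[2h%4]+4[2h%3]≤2h 8 _ = ℕP.≤ᵇ⇒≤ _ _ tt
  3[2h%4]+4[2h%3]≤2h h@(suc (suc (suc (suc (suc (suc (suc (suc (suc _))))))))) _ = begin
    3 ℕ.* (2 ℕ.* h % 4) ℕ.+ 4 ℕ.* (2 ℕ.* h % 3) ≤⟨ ℕP.+-mono-≤ (ℕP.*-monoʳ-≤ 3 (ℕ.s≤s⁻¹ (ℕD.m%n<n (2 ℕ.* h) 4)))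
                                                               (ℕP.*-monoʳ-≤ 4 (ℕ.s≤s⁻¹ (ℕD.m%n<n (2 ℕ.* h) 3))) ⟩
    17                                          ≤⟨ ℕP.n≤1+n 17 ⟩
    2 ℕ.* 9                                     ≤⟨ ℕP.*-monoʳ-≤ 2 (ℕP.≤ᵇ⇒≤ 9 h tt) ⟩
    2 ℕ.* h                                     ∎
    where open ℕP.≤-Reasoning

  odd-prime⇒p-1≡2*[p/2] : ∀ {p} → Prime p → p ≢ 2 → p ∸ 1 ≡ 2 ℕ.* (p ℕ./ 2)
  odd-prime⇒p-1≡2*[p/2] {p} p-prime p≢2 = begin
    p ∸ 1                            ≡⟨ cong (_∸ 1) (ℕD.m≡m%n+[m/n]*n p 2) ⟩
    p % 2 ℕ.+ p ℕ./ 2 ℕ.* 2 ∸ 1      ≡⟨ cong (λ r → r ℕ.+ p ℕ./ 2 ℕ.* 2 ∸ 1) p%2≡1 ⟩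
    p ℕ./ 2 ℕ.* 2                    ≡⟨ ℕP.*-comm (p ℕ./ 2) 2 ⟩
    2 ℕ.* (p ℕ./ 2)                  ∎
    where
    open ≡-Reasoning
    p%2≡1 : p % 2 ≡ 1
    p%2≡1 with p % 2 in p%2≡r | ℕD.m%n<n p 2
    ... | 1           | _ = refl
    ... | suc (suc _) | s≤s (s≤s ())
    ... | 0           | _ with prime⇒irreducible p-prime (m%n≡0⇒n∣m p 2 p%2≡r)
    ...   | inj₁ ()
    ...   | inj₂ 2≡p = ⊥-elim (p≢2 (sym 2≡p))

  3[δ%4]+4[δ%3]≤δ : ∀ p → Prime p → 4 ℕ.≤ p → 3 ℕ.* (δ p % 4) ℕ.+ 4 ℕ.* (δ p % 3) ℕ.≤ δ p
  3[δ%4]+4[δ%3]≤δ 2 _ (s≤s (s≤s ()))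
  3[δ%4]+4[δ%3]≤δ 3 _ (s≤s (s≤s (s≤s ())))
  3[δ%4]+4[δ%3]≤δ p@(suc (suc (suc (suc _)))) p-prime 4≤p =
    subst (λ d → 3 ℕ.* (d % 4) ℕ.+ 4 ℕ.* (d % 3) ℕ.≤ d) (sym (odd-prime⇒p-1≡2*[p/2] p-prime λ ()))
      (3[2h%4]+4[2h%3]≤2h (p ℕ./ 2) (ℕD./-monoˡ-≤ 2 4≤p))

  ℕ-combination-≤ : ∀ {a b c X Y M} → 0ℚ ≤ M → X ≤ M → Y ≤ M → a ℕ.+ b ℕ.≤ c →
    ℕ→ℚ a * X + ℕ→ℚ b * Y ≤ ℕ→ℚ c * M
  ℕ-combination-≤ {a} {b} {c} {X} {Y} {M} 0≤M X≤M Y≤M a+b≤c = begin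
    ℕ→ℚ a * X + ℕ→ℚ b * Y  ≤⟨ ℚP.+-mono-≤ (*-monoˡ-≤-0≤ (ℕ→ℚ-nonNeg a) X≤M) (*-monoˡ-≤-0≤ (ℕ→ℚ-nonNeg b) Y≤M) ⟩
    ℕ→ℚ a * M + ℕ→ℚ b * M  ≡⟨ ℚP.*-distribʳ-+ M (ℕ→ℚ a) (ℕ→ℚ b) ⟨
    (ℕ→ℚ a + ℕ→ℚ b) * M    ≡⟨ cong (_* M) (ℕ→ℚ-homo-+ a b) ⟨
    ℕ→ℚ (a ℕ.+ b) * M      ≤⟨ *-monoʳ-≤-0≤ 0≤M (ℕ→ℚ-mono-≤ a+b≤c) ⟩
    ℕ→ℚ c * M              ∎
    where open ℚP.≤-Reasoning

  6μ₀₂+8μ₀₃≤2μ₀ : ∀ N → 2 ℕ.≤ N → ℕ→ℚ 6 * μ₀₂ N + ℕ→ℚ 8 * μ₀₃ N ≤ ℕ→ℚ 2 * μ₀ N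
  6μ₀₂+8μ₀₃≤2μ₀ N 2≤N = ℚP.≤-trans (ℚP.≤-reflexive (double (μ₀₂ N) (μ₀₃ N)))
    (*-monoˡ-≤-0≤ (ℕ→ℚ-nonNeg 2) (3μ₀₂+4μ₀₃≤μ₀ N 2≤N))
    where
    double : ∀ x y → ℕ→ℚ 6 * x + ℕ→ℚ 8 * y ≡ ℕ→ℚ 2 * (ℕ→ℚ 3 * x + ℕ→ℚ 4 * y)
    double = solve 2 (λ x y →
      con (ℕ→ℚ 6) :* x :+ con (ℕ→ℚ 8) :* y := con (ℕ→ℚ 2) :* (con (ℕ→ℚ 3) :* x :+ con (ℕ→ℚ 4) :* y)) refl

  correction≤δμ₀ : ∀ p N → Prime p → 1 ℕ.≤ N → 3 ℕ.< p ℕ.* N →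
    ℕ→ℚ (3 ℕ.* (δ p % 4)) * μ₀₂ N + ℕ→ℚ (4 ℕ.* (δ p % 3)) * μ₀₃ N ≤ ℕ→ℚ (δ p) * μ₀ N
  correction≤δμ₀ 0 _ p-prime = ⊥-elim (¬prime[0] p-prime)
  correction≤δμ₀ 1 _ p-prime = ⊥-elim (¬prime[1] p-prime)
  correction≤δμ₀ 2 1 _ _ (s≤s (s≤s ()))
  correction≤δμ₀ 3 1 _ _ (s≤s (s≤s (s≤s ())))
  correction≤δμ₀ 2 N@(suc (suc _)) _ _ _ = 6μ₀₂+8μ₀₃≤2μ₀ N (s≤s (s≤s z≤n))
  correction≤δμ₀ 3 N@(suc (suc _)) _ _ _ = 6μ₀₂+8μ₀₃≤2μ₀ N (s≤s (s≤s z≤n))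
  correction≤δμ₀ p@(suc (suc (suc (suc _)))) N@(suc _) p-prime _ _ =
    ℕ-combination-≤ {3 ℕ.* (δ p % 4)} {4 ℕ.* (δ p % 3)} (0≤μ₀ N) (proj₂ (0≤μ₀₂≤μ₀ N)) (proj₂ (0≤μ₀₃≤μ₀ N))
      (3[δ%4]+4[δ%3]≤δ p p-prime (s≤s (s≤s (s≤s (s≤s z≤n)))))

  D-mono-+δ : ∀ p N → Prime p → 1 ℕ.≤ N → 3 ℕ.< p ℕ.* N → ∀ k → D N k ≤ D N (k ℤ.+ + δ p)
  D-mono-+δ p N p-prime 1≤N 3<pN =
    Dformula-mono-+δ (δ p) (proj₁ (0≤μ₀₂≤∏ε₄ N)) (proj₁ (0≤μ₀₃≤∏ε₃ N)) (correction≤δμ₀ p N p-prime 1≤N 3<pN)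

  -- The weight 1 + (a/p) of μ₀₂ (a = −4) or μ₀₃ (a = −3) in 2 d + dⁿᵉʷ.
  newformWeight : ℤ → ℕ → ℚ
  newformWeight a p = ℕ→ℚ 2 + ℤ→ℚ (ℤ.- (+ 1) ℤ.+ kroneckerPrime a p)

  0≤newformWeight≤2 : ∀ a p → 0ℚ ≤ newformWeight a p × newformWeight a p ≤ ℕ→ℚ 2
  0≤newformWeight≤2 a p =
    ℚP.≤-trans (ℤ→ℚ-mono-≤ {0ℤ} (ℤP.+-monoʳ-≤ (+ 2) (ℤP.+-monoʳ-≤ -1ℤ -1≤χ))) (ℚP.≤-reflexive w≡) ,
    ℚP.≤-trans (ℚP.≤-reflexive (sym w≡)) (ℤ→ℚ-mono-≤ {j = + 2} (ℤP.+-monoʳ-≤ (+ 2) (ℤP.+-monoʳ-≤ -1ℤ χ≤1)))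
    where
    -1≤χ : -1ℤ ℤ.≤ kroneckerPrime a p
    -1≤χ = proj₁ (-1≤kroneckerPrime≤1 a p)
    χ≤1 : kroneckerPrime a p ℤ.≤ 1ℤ
    χ≤1 = proj₂ (-1≤kroneckerPrime≤1 a p)
    w≡ : ℤ→ℚ (+ 2 ℤ.+ (-1ℤ ℤ.+ kroneckerPrime a p)) ≡ newformWeight a p
    w≡ = ℤ→ℚ-homo-+ (+ 2) (-1ℤ ℤ.+ kroneckerPrime a p)

  2D+Dnew≡Dformula : ∀ p N k → ℕ→ℚ 2 * D N k + Dnew p N k ≡
    Dformula k ((ℕ→ℚ 2 + ℕ→ℚ (p ∸ 1)) * μ₀ N) (newformWeight (ℤ.- + 4) p * μ₀₂ N)
               (newformWeight (ℤ.- + 3) p * μ₀₃ N) (ℕ→ℚ 2 * (c₀ N * (+ 1 / 2)))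
  2D+Dnew≡Dformula p N k = regroup ((k ℤ.- + 1) / 12) (corr k 4) (corr k 3) (μ₀ N) (μ₀₂ N) (μ₀₃ N)
    (c₀ N * (+ 1 / 2)) (ℕ→ℚ (p ∸ 1)) (ℤ→ℚ (ℤ.- (+ 1) ℤ.+ kroneckerPrime (ℤ.- + 4) p))
    (ℤ→ℚ (ℤ.- (+ 1) ℤ.+ kroneckerPrime (ℤ.- + 3) p))
    where
    regroup : ∀ A c₄ c₃ μ μ₂ μ₃ C P E₄ E₃ →
      ℕ→ℚ 2 * (A * μ + c₄ * μ₂ + c₃ * μ₃ - C) + (A * P * μ + c₄ * E₄ * μ₂ + c₃ * E₃ * μ₃)
      ≡ A * ((ℕ→ℚ 2 + P) * μ) + c₄ * ((ℕ→ℚ 2 + E₄) * μ₂) + c₃ * ((ℕ→ℚ 2 + E₃) * μ₃) - ℕ→ℚ 2 * C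
    regroup = solve 10 (λ A c₄ c₃ μ μ₂ μ₃ C P E₄ E₃ →
        con (ℕ→ℚ 2) :* (A :* μ :+ c₄ :* μ₂ :+ c₃ :* μ₃ :- C) :+ (A :* P :* μ :+ c₄ :* E₄ :* μ₂ :+ c₃ :* E₃ :* μ₃)
      := A :* ((con (ℕ→ℚ 2) :+ P) :* μ) :+ c₄ :* ((con (ℕ→ℚ 2) :+ E₄) :* μ₂) :+ c₃ :* ((con (ℕ→ℚ 2) :+ E₃) :* μ₃)
           :- con (ℕ→ℚ 2) :* C)
      refl

  reweight-≤ : ∀ {α β X Y Z w₁ w₂ w} → 0ℚ ≤ α → 0ℚ ≤ β → 0ℚ ≤ X → 0ℚ ≤ Y → 0ℚ ≤ w → w₁ ≤ w → w₂ ≤ w →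
    α * X + β * Y ≤ Z → α * (w₁ * X) + β * (w₂ * Y) ≤ w * Z
  reweight-≤ {α} {β} {X} {Y} {Z} {w₁} {w₂} {w} 0≤α 0≤β 0≤X 0≤Y 0≤w w₁≤w w₂≤w αX+βY≤Z = begin
    α * (w₁ * X) + β * (w₂ * Y) ≤⟨ ℚP.+-mono-≤ (*-monoˡ-≤-0≤ 0≤α (*-monoʳ-≤-0≤ 0≤X w₁≤w))
                                               (*-monoˡ-≤-0≤ 0≤β (*-monoʳ-≤-0≤ 0≤Y w₂≤w)) ⟩
    α * (w * X) + β * (w * Y)   ≡⟨ factor α β w X Y ⟩
    w * (α * X + β * Y)         ≤⟨ *-monoˡ-≤-0≤ 0≤w αX+βY≤Z ⟩
    w * Z                       ∎
    where
    open ℚP.≤-Reasoning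
    factor : ∀ α β w X Y → α * (w * X) + β * (w * Y) ≡ w * (α * X + β * Y)
    factor = solve 5 (λ α β w X Y → α :* (w :* X) :+ β :* (w :* Y) := w :* (α :* X :+ β :* Y)) refl

  weightedCorrection≤δμ₀ : ∀ p N → Prime p → 1 ℕ.≤ N → 3 ℕ.< p ℕ.* N →
    ℕ→ℚ (3 ℕ.* (δ p % 4)) * (newformWeight (ℤ.- + 4) p * μ₀₂ N)
      + ℕ→ℚ (4 ℕ.* (δ p % 3)) * (newformWeight (ℤ.- + 3) p * μ₀₃ N)
    ≤ ℕ→ℚ (δ p) * ((ℕ→ℚ 2 + ℕ→ℚ (p ∸ 1)) * μ₀ N)
  weightedCorrection≤δμ₀ p N p-prime 1≤N 3<pN = begin
    ℕ→ℚ (3 ℕ.* (δ p % 4)) * (newformWeight (ℤ.- + 4) p * μ₀₂ N)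
      + ℕ→ℚ (4 ℕ.* (δ p % 3)) * (newformWeight (ℤ.- + 3) p * μ₀₃ N)
        ≤⟨ reweight-≤ (ℕ→ℚ-nonNeg (3 ℕ.* (δ p % 4))) (ℕ→ℚ-nonNeg (4 ℕ.* (δ p % 3)))
             (proj₁ (0≤μ₀₂≤∏ε₄ N)) (proj₁ (0≤μ₀₃≤∏ε₃ N)) (ℕ→ℚ-nonNeg 2)
             (proj₂ (0≤newformWeight≤2 (ℤ.- + 4) p)) (proj₂ (0≤newformWeight≤2 (ℤ.- + 3) p))
             (correction≤δμ₀ p N p-prime 1≤N 3<pN) ⟩
    ℕ→ℚ 2 * (Δ * μ₀ N)                   ≤⟨ p≤p+q (0≤p*q (ℕ→ℚ-nonNeg (p ∸ 1)) (0≤p*q (ℕ→ℚ-nonNeg (δ p)) (0≤μ₀ N))) ⟩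
    ℕ→ℚ 2 * (Δ * μ₀ N) + P * (Δ * μ₀ N)  ≡⟨ split Δ P (μ₀ N) ⟨
    Δ * ((ℕ→ℚ 2 + P) * μ₀ N)             ∎
    where
    open ℚP.≤-Reasoning
    instance
      N-nonZero : NonZero N
      N-nonZero = ℕ.>-nonZero 1≤N
    Δ = ℕ→ℚ (δ p)
    P = ℕ→ℚ (p ∸ 1)
    split : ∀ Δ P μ → Δ * ((ℕ→ℚ 2 + P) * μ) ≡ ℕ→ℚ 2 * (Δ * μ) + P * (Δ * μ)
    split = solve 3 (λ Δ P μ → Δ :* ((con (ℕ→ℚ 2) :+ P) :* μ) := con (ℕ→ℚ 2) :* (Δ :* μ) :+ P :* (Δ :* μ)) refl

  2D+Dnew-mono-+δ : ∀ p N → Prime p → 1 ℕ.≤ N → 3 ℕ.< p ℕ.* N →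
    ∀ k → ℕ→ℚ 2 * D N k + Dnew p N k ≤ ℕ→ℚ 2 * D N (k ℤ.+ + δ p) + Dnew p N (k ℤ.+ + δ p)
  2D+Dnew-mono-+δ p N p-prime 1≤N 3<pN k =
    subst₂ _≤_ (sym (2D+Dnew≡Dformula p N k)) (sym (2D+Dnew≡Dformula p N (k ℤ.+ + δ p)))
      (Dformula-mono-+δ (δ p) (0≤p*q (proj₁ (0≤newformWeight≤2 (ℤ.- + 4) p)) (proj₁ (0≤μ₀₂≤∏ε₄ N)))
                              (0≤p*q (proj₁ (0≤newformWeight≤2 (ℤ.- + 3) p)) (proj₁ (0≤μ₀₃≤∏ε₃ N)))
                              (weightedCorrection≤δμ₀ p N p-prime 1≤N 3<pN) k)

  module _ {a ℓ₁ ℓ₂} (P : Preorder a ℓ₁ ℓ₂) where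
    open Preorder P using (_≲_) renaming (Carrier to A; refl to ≲-refl; trans to ≲-trans)

    mono-from-suc : (f : ℤ → A) → (∀ n → f n ≲ f (ℤ.suc n)) → ∀ m n → m ℤ.≤ n → f m ≲ f n
    mono-from-suc f step m n m≤n = subst (λ i → f m ≲ f i) [n-m]+m≡n (f-m≲f-[j+m] ℤ.∣ n ℤ.- m ∣)
      where
      f-m≲f-[j+m] : ∀ j → f m ≲ f (+ j ℤ.+ m)
      f-m≲f-[j+m] zero    = subst (λ i → f m ≲ f i) (sym (ℤP.+-identityˡ m)) ≲-refl
      f-m≲f-[j+m] (suc j) = subst (λ i → f m ≲ f i) (sym (ℤP.suc-+ j m)) (≲-trans (f-m≲f-[j+m] j) (step (+ j ℤ.+ m)))
      cancel : ∀ n m → n ℤ.- m ℤ.+ m ≡ n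
      cancel = solve-ℤ
      [n-m]+m≡n : + ℤ.∣ n ℤ.- m ∣ ℤ.+ m ≡ n
      [n-m]+m≡n = trans (cong (ℤ._+ m) (ℤP.0≤i⇒+∣i∣≡i (ℤP.i≤j⇒0≤j-i m≤n))) (cancel n m)

  kₙ-suc : ∀ p k₀ n → kₙ p k₀ (ℤ.suc n) ≡ kₙ p k₀ n ℤ.+ + δ p
  kₙ-suc p k₀ n = distrib (+ k₀) n (+ δ p)
    where
    distrib : ∀ a n d → a ℤ.+ (+ 1 ℤ.+ n) ℤ.* d ≡ a ℤ.+ n ℤ.* d ℤ.+ d
    distrib = solve-ℤ

  ℚ-≤-preorder : Preorder 0ℓ 0ℓ 0ℓ
  ℚ-≤-preorder = TotalPreorder.preorder ℚP.≤-totalPreorder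

open import Data.Nat using (_≤_; _<_; _*_; _+_)

proposition5p2 : (p N k₀ : ℕ) → Prime p → 1 ≤ N → ¬ (p ∣ N) → 3 < p * N
    → 2 ∣ k₀ → 2 ≤ k₀ → k₀ < p + 1
    → (∀ (m n : ℤ) → m ℤ.≤ n → d p N k₀ m ℚ.≤ d p N k₀ n)
    × (∀ (m n : ℤ) → m ℤ.≤ n → dₚ p N k₀ m ℚ.≤ dₚ p N k₀ n)
proposition5p2 p N k₀ p-prime 1≤N _ 3<pN _ _ _ =
  mono-from-suc ℚ-≤-preorder (d p N k₀) (along-kₙ (D-mono-+δ p N p-prime 1≤N 3<pN)) ,
  mono-from-suc ℚ-≤-preorder (dₚ p N k₀) (along-kₙ (2D+Dnew-mono-+δ p N p-prime 1≤N 3<pN))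
  where
  along-kₙ : {F : ℤ → ℚ} → (∀ k → F k ℚ.≤ F (k ℤ.+ + δ p)) → ∀ n → F (kₙ p k₀ n) ℚ.≤ F (kₙ p k₀ (ℤ.suc n))
  along-kₙ {F} step n = subst (λ k → F (kₙ p k₀ n) ℚ.≤ F k) (sym (kₙ-suc p k₀ n)) (step (kₙ p k₀ n))
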